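{- Let $G$ be a graph with $v$ vertices and average vertex degree $D$, and let $k$ be a positive integer. Then \[ O\!\chi_k(G)\ge \left\lceil\frac{vk}{v-D-1+k}\right\rceil. \]
   Context: All graphs are finite simple graphs. An $n$-coloring of a graph $G$ is a proper vertex coloring using at most $n$ colors. Two colorings $C_1,C_2$ of $G$ are orthogonal if whenever two distinct vertices share a color in $C_1$, they have distinct colors in $C_2$. The $k$-orthogonal chromatic number $O\!\chi_k(G)$ is the minimum $n$ such that there exist $k$ pairwise orthogonal $n$-colorings of $G$. -}

module Defs where

open import Data.Nat using (ℕ; zero; suc; _+_; _*_; _∸_; _/_; _≤_; _<_)
open import Data.Bool using (Bool; true; false; if_then_else_)
open import Data.Fin using (Fin)
open import Data.List using (map; allFin)
open import Data.Nat.ListAction using (sum)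
open import Data.Product using (_×_; Σ)
open import Relation.Binary.PropositionalEquality using (_≡_; _≢_)
open import Relation.Nullary using (¬_)

record Graph (v : ℕ) : Set where
  field
    Adj     : Fin v → Fin v → Bool
    symm    : ∀ x y → Adj x y ≡ Adj y x
    irrefl  : ∀ x → Adj x x ≡ false
open Graph public

degree : ∀ {v} → Graph v → Fin v → ℕ
degree G x = sum (map (λ y → if Adj G x y then 1 else 0) (allFin _))

-- sum of all vertex degrees (= 2|E|); the average degree is D = degSum G / v
degSum : ∀ {v} → Graph v → ℕ
degSum {v} G = sum (map (degree G) (allFin v))

Coloring : ∀ {v} → Graph v → ℕ → Set
Coloring {v} G n = Fin v → Fin n

Proper : ∀ {v} (G : Graph v) {n} → Coloring G n → Set
Proper G c = ∀ x y → Adj G x y ≡ true → c x ≢ c y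

Orthogonal : ∀ {v} (G : Graph v) {n} → Coloring G n → Coloring G n → Set
Orthogonal G c₁ c₂ = ∀ x y → x ≢ y → c₁ x ≡ c₁ y → c₂ x ≢ c₂ y

HasOrthColorings : ∀ {v} → ℕ → Graph v → ℕ → Set
HasOrthColorings k G n =
  Σ (Fin k → Coloring G n) λ cs →
    (∀ i → Proper G (cs i)) × (∀ i j → i ≢ j → Orthogonal G (cs i) (cs j))

IsOrthChromaticNumber : ∀ {v} → ℕ → Graph v → ℕ → Set
IsOrthChromaticNumber k G n =
  HasOrthColorings k G n × (∀ m → m < n → ¬ HasOrthColorings k G m)

-- ceiling division ⌈ a / b ⌉ (value for b = 0 is an irrelevant junk value 0)
ceilDiv : ℕ → ℕ → ℕ
ceilDiv a zero = 0
ceilDiv a (suc b) = (a + b) / suc b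

-- ⌈ v k / (v - D - 1 + k) ⌉ with D = degSum / v, after multiplying numerator
-- and denominator by v:  ⌈ v² k / (v (v - 1 + k) - degSum) ⌉
bound : ∀ {v} → ℕ → Graph v → ℕ
bound {v} k G = ceilDiv (v * v * k) (v * (v ∸ 1 + k) ∸ degSum G)

-- The proof is a double count of the triples (i, x, y) such that the i-th of k
-- pairwise orthogonal proper n-colourings gives the vertices x and y the same colour.
--  * From below: a single colouring f of v vertices with n colours has at least v²/n
--    such ordered pairs, by Cauchy–Schwarz applied to its colour-class sizes.
--    Hence the number of triples is at least k v² / n.
--  * From above: x and x agree in all k colourings; distinct x, y agree in at most one
--    colouring (orthogonality), and in none if they are adjacent (properness).
--    Adding the adjacency count, every row x contributes at most k + (v - 1), so
--    triples + 2|E| ≤ v (v - 1 + k).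
-- Comparing gives k v² ≤ n (v (v - 1 + k) - 2|E|), which is the bound after clearing
-- denominators.
module Submission where

open import Defs
open import Data.Nat using (ℕ; _≤_; NonZero)

open import Data.Nat.Base using (zero; suc; _+_; _*_; _∸_; z≤n; s≤s; s≤s⁻¹)
open import Data.Nat.Properties
  using (+-*-semiring; +-comm; +-identityʳ; *-comm; *-identityʳ; +-mono-≤; +-monoʳ-≤;
         *-monoʳ-≤; *-cancelˡ-≤; ≤-trans; ≤-reflexive; ≤-total; m≤m+n;
         m≤n⇒∃[o]m+o≡n; m+n≤o⇒m≤o∸n; module ≤-Reasoning)
open import Data.Nat.DivMod using (m<n*o⇒m/o<n)
open import Data.Nat.Tactic.RingSolver using (solve-∀)
open import Data.Nat.ListAction using () renaming (sum to listSum)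
open import Algebra.Properties.Semiring.Sum +-*-semiring
  using (sum-syntax; sum-cong-≗; sum-replicate-zero; sum-remove; ∑-distrib-+; ∑-comm;
         *-distribˡ-sum; *-distribʳ-sum)
open import Data.Fin.Base using (Fin; zero; suc; punchIn)
open import Data.Fin.Properties using (_≟_; suc-injective; punchInᵢ≢i)
open import Data.List.Base using (map; tabulate)
open import Data.Bool.Base using (true; false; if_then_else_)
open import Data.Product.Base using (_,_)
open import Data.Sum.Base using (inj₁; inj₂)
open import Relation.Binary.PropositionalEquality
  using (_≡_; _≢_; refl; sym; trans; cong; cong₂; subst; subst₂; module ≡-Reasoning)
open import Relation.Nullary.Decidable using (does; yes; no; dec-true; dec-false)
open import Function.Base using (id; _∘_)

∑-const : ∀ n c → ∑[ i < n ] c ≡ n * c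
∑-const zero    c = refl
∑-const (suc n) c = cong (c +_) (∑-const n c)

∑-ones : ∀ n → ∑[ i < n ] 1 ≡ n
∑-ones n = trans (∑-const n 1) (*-identityʳ n)

∑-zero : ∀ {n} {f : Fin n → ℕ} → (∀ i → f i ≡ 0) → ∑[ i < n ] f i ≡ 0
∑-zero {n} f≗0 = trans (sum-cong-≗ f≗0) (sum-replicate-zero n)

∑-mono-≤ : ∀ {n} {f g : Fin n → ℕ} → (∀ i → f i ≤ g i) → ∑[ i < n ] f i ≤ ∑[ i < n ] g i
∑-mono-≤ {zero}  f≤g = z≤n
∑-mono-≤ {suc n} f≤g = +-mono-≤ (f≤g zero) (∑-mono-≤ (f≤g ∘ suc))

listSum-tabulate : ∀ {A : Set} n (g : Fin n → A) (f : A → ℕ) →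
  listSum (map f (tabulate g)) ≡ ∑[ i < n ] f (g i)
listSum-tabulate zero    g f = refl
listSum-tabulate (suc n) g f = cong (f (g zero) +_) (listSum-tabulate n (g ∘ suc) f)

∑-diagonal-bound : ∀ {w k} (x : Fin (suc w)) (f : Fin (suc w) → ℕ) →
  f x ≤ k → (∀ y → x ≢ y → f y ≤ 1) → ∑[ y < suc w ] f y ≤ k + w
∑-diagonal-bound {w} {k} x f fx≤k others≤1 = begin
  ∑[ y < suc w ] f y                ≡⟨ sum-remove f ⟩
  f x + ∑[ y < w ] f (punchIn x y)  ≤⟨ +-mono-≤ fx≤k (∑-mono-≤ others) ⟩
  k + ∑[ y < w ] 1                  ≡⟨ cong (k +_) (∑-ones w) ⟩
  k + w                             ∎
  where
  open ≤-Reasoning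
  others : ∀ y → f (punchIn x y) ≤ 1
  others y = others≤1 (punchIn x y) (punchInᵢ≢i x y ∘ sym)

-- For a ≤ b write b = a + d; then a² + b² = 2ab + d².
am-gm-ordered : ∀ {a b} → a ≤ b → 2 * (a * b) ≤ a * a + b * b
am-gm-ordered {a} a≤b with m≤n⇒∃[o]m+o≡n a≤b
... | d , refl = subst (2 * (a * (a + d)) ≤_) (expand a d) (m≤m+n _ (d * d))
  where
  expand : ∀ a d → 2 * (a * (a + d)) + d * d ≡ a * a + (a + d) * (a + d)
  expand = solve-∀

am-gm : ∀ a b → 2 * (a * b) ≤ a * a + b * b
am-gm a b with ≤-total a b
... | inj₁ a≤b = am-gm-ordered a≤b
... | inj₂ b≤a = subst₂ _≤_ (cong (2 *_) (*-comm b a)) (+-comm (b * b) (a * a)) (am-gm-ordered b≤a)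

square-∑ : ∀ n (a : Fin n → ℕ) →
  (∑[ i < n ] a i) * (∑[ i < n ] a i) ≡ ∑[ i < n ] ∑[ j < n ] (a i * a j)
square-∑ n a = trans (*-distribʳ-sum _ a) (sum-cong-≗ (λ i → *-distribˡ-sum (a i) a))

∑∑-squares : ∀ n (a : Fin n → ℕ) →
  ∑[ i < n ] ∑[ j < n ] (a i * a i + a j * a j) ≡ 2 * (n * ∑[ i < n ] (a i * a i))
∑∑-squares n a = begin
  ∑[ i < n ] ∑[ j < n ] (a i * a i + a j * a j)   ≡⟨ sum-cong-≗ (λ i → ∑-distrib-+ (λ j → a i * a i) (λ j → a j * a j)) ⟩
  ∑[ i < n ] (∑[ j < n ] (a i * a i) + q)         ≡⟨ sum-cong-≗ (λ i → cong (_+ q) (∑-const n (a i * a i))) ⟩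
  ∑[ i < n ] (n * (a i * a i) + q)                ≡⟨ ∑-distrib-+ (λ i → n * (a i * a i)) (λ _ → q) ⟩
  ∑[ i < n ] (n * (a i * a i)) + ∑[ i < n ] q     ≡⟨ cong₂ _+_ (sym (*-distribˡ-sum n (λ i → a i * a i))) (∑-const n q) ⟩
  n * q + n * q                                   ≡⟨ cong (n * q +_) (sym (+-identityʳ (n * q))) ⟩
  2 * (n * q)                                     ∎
  where
  open ≡-Reasoning
  q = ∑[ i < n ] (a i * a i)

-- Cauchy–Schwarz (∑ aᵢ)² ≤ n ∑ aᵢ²: expand both sides as double sums and apply
-- 2aᵢaⱼ ≤ aᵢ² + aⱼ² termwise.
cauchy-schwarz : ∀ n (a : Fin n → ℕ) →
  (∑[ i < n ] a i) * (∑[ i < n ] a i) ≤ n * ∑[ i < n ] (a i * a i)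
cauchy-schwarz n a = *-cancelˡ-≤ 2 (begin
  2 * (s * s)                                     ≡⟨ cong (2 *_) (square-∑ n a) ⟩
  2 * ∑[ i < n ] ∑[ j < n ] (a i * a j)           ≡⟨ double ⟩
  ∑[ i < n ] ∑[ j < n ] (2 * (a i * a j))         ≤⟨ ∑-mono-≤ (λ i → ∑-mono-≤ (λ j → am-gm (a i) (a j))) ⟩
  ∑[ i < n ] ∑[ j < n ] (a i * a i + a j * a j)   ≡⟨ ∑∑-squares n a ⟩
  2 * (n * ∑[ i < n ] (a i * a i))                ∎)
  where
  open ≤-Reasoning
  s = ∑[ i < n ] a i
  double : 2 * ∑[ i < n ] ∑[ j < n ] (a i * a j) ≡ ∑[ i < n ] ∑[ j < n ] (2 * (a i * a j))
  double = trans (*-distribˡ-sum 2 (λ i → ∑[ j < n ] (a i * a j))) (sum-cong-≗ (λ i → *-distribˡ-sum 2 (λ j → a i * a j)))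

δ : ∀ {n} → Fin n → Fin n → ℕ
δ a b = if does (a ≟ b) then 1 else 0

δ-refl : ∀ {n} (a : Fin n) → δ a a ≡ 1
δ-refl a = cong (if_then 1 else 0) (dec-true (a ≟ a) refl)

δ-≢ : ∀ {n} {a b : Fin n} → a ≢ b → δ a b ≡ 0
δ-≢ {a = a} {b} a≢b = cong (if_then 1 else 0) (dec-false (a ≟ b) a≢b)

-- Sifting: summing against δ picks out one value.  Note δ (suc c) (suc a) reduces to
-- δ c a, and δ vanishes definitionally on zero/suc pairs.
∑-δ : ∀ {n} (a : Fin n) (g : Fin n → ℕ) → ∑[ c < n ] (δ c a * g c) ≡ g a
∑-δ {suc n} zero    g = trans (cong₂ _+_ (+-identityʳ (g zero)) (sum-replicate-zero n)) (+-identityʳ (g zero))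
∑-δ {suc n} (suc a) g = ∑-δ a (g ∘ suc)

∑-δ-one : ∀ {n} (a : Fin n) → ∑[ c < n ] δ c a ≡ 1
∑-δ-one a = trans (sum-cong-≗ (λ c → sym (*-identityʳ (δ c a)))) (∑-δ a (λ _ → 1))

classSize : ∀ {v n} → (Fin v → Fin n) → Fin n → ℕ
classSize {v} f c = ∑[ x < v ] δ c (f x)

collisions : ∀ {v n} → (Fin v → Fin n) → ℕ
collisions {v} f = ∑[ x < v ] ∑[ y < v ] δ (f x) (f y)

∑-classSize : ∀ {v n} (f : Fin v → Fin n) → ∑[ c < n ] classSize f c ≡ v
∑-classSize {v} f = trans (∑-comm (λ c x → δ c (f x))) (trans (sum-cong-≗ (λ x → ∑-δ-one (f x))) (∑-ones v))

-- Each vertex x collides with exactly the members of its own class, so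
-- collisions f = ∑ₓ |class (f x)| = ∑_c |class c|².
∑-classSize² : ∀ {v n} (f : Fin v → Fin n) →
  ∑[ c < n ] (classSize f c * classSize f c) ≡ collisions f
∑-classSize² {v} {n} f = begin
  ∑[ c < n ] (classSize f c * classSize f c)      ≡⟨ sum-cong-≗ (λ c → *-distribʳ-sum (classSize f c) (λ x → δ c (f x))) ⟩
  ∑[ c < n ] ∑[ x < v ] (δ c (f x) * classSize f c) ≡⟨ ∑-comm (λ c x → δ c (f x) * classSize f c) ⟩
  ∑[ x < v ] ∑[ c < n ] (δ c (f x) * classSize f c) ≡⟨ sum-cong-≗ (λ x → ∑-δ (f x) (classSize f)) ⟩
  ∑[ x < v ] classSize f (f x)                     ∎
  where open ≡-Reasoning

collision-bound : ∀ {v n} (f : Fin v → Fin n) → v * v ≤ n * collisions f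
collision-bound {n = n} f =
  subst₂ (λ s q → s * s ≤ n * q) (∑-classSize f) (∑-classSize² f) (cauchy-schwarz n (classSize f))

atMostOneAgreement : ∀ {k n} (a b : Fin k → Fin n) →
  (∀ i j → i ≢ j → a i ≡ b i → a j ≢ b j) → ∑[ i < k ] δ (a i) (b i) ≤ 1
atMostOneAgreement {zero}  a b unique = z≤n
atMostOneAgreement {suc k} a b unique with a zero ≟ b zero
... | yes a₀≡b₀ = ≤-reflexive (cong suc (∑-zero (λ i → δ-≢ (unique zero (suc i) (λ ()) a₀≡b₀))))
... | no  _     = atMostOneAgreement (a ∘ suc) (b ∘ suc) (λ i j i≢j → unique (suc i) (suc j) (i≢j ∘ suc-injective))

module OrthogonalFamily {w k n} (G : Graph (suc w)) (cs : Fin k → Coloring G n)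
  (proper : ∀ i → Proper G (cs i)) (orth : ∀ i j → i ≢ j → Orthogonal G (cs i) (cs j)) where

  v : ℕ
  v = suc w

  adj : Fin v → Fin v → ℕ
  adj x y = if Adj G x y then 1 else 0

  agreements : Fin v → Fin v → ℕ
  agreements x y = ∑[ i < k ] δ (cs i x) (cs i y)

  diagonal : ∀ x → agreements x x + adj x x ≤ k
  diagonal x = ≤-reflexive (begin
    agreements x x + adj x x ≡⟨ cong₂ _+_ (sum-cong-≗ (λ i → δ-refl (cs i x))) (cong (if_then 1 else 0) (irrefl G x)) ⟩
    ∑[ i < k ] 1 + 0         ≡⟨ +-identityʳ _ ⟩
    ∑[ i < k ] 1             ≡⟨ ∑-ones k ⟩
    k                        ∎)
    where open ≡-Reasoning

  -- Distinct vertices agree in no colouring if adjacent (properness) and in at most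
  -- one colouring otherwise (orthogonality).
  offDiagonal : ∀ {x y} → x ≢ y → agreements x y + adj x y ≤ 1
  offDiagonal {x} {y} x≢y with Adj G x y in x~y
  ... | true  = ≤-reflexive (cong (_+ 1) (∑-zero (λ i → δ-≢ (proper i x y x~y))))
  ... | false = subst (_≤ 1) (sym (+-identityʳ _))
                  (atMostOneAgreement (λ i → cs i x) (λ i → cs i y) (λ i j i≢j → orth i j i≢j x y x≢y))

  -- Every row contributes at most k + (v - 1), hence the total is at most v (k + w).
  pairBound : ∑[ x < v ] ∑[ y < v ] (agreements x y + adj x y) ≤ v * (k + w)
  pairBound = ≤-trans (∑-mono-≤ row) (≤-reflexive (∑-const v (k + w)))
    where
    row : ∀ x → ∑[ y < v ] (agreements x y + adj x y) ≤ k + w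
    row x = ∑-diagonal-bound x (λ y → agreements x y + adj x y) (diagonal x) (λ y → offDiagonal)

  degSum-adj : degSum G ≡ ∑[ x < v ] ∑[ y < v ] adj x y
  degSum-adj = trans (listSum-tabulate v id (degree G))
                     (sum-cong-≗ (λ x → listSum-tabulate v id (adj x)))

  -- Counting the agreeing triples (i, x, y) by colouring or by vertex pair.
  totalCollisions : ℕ
  totalCollisions = ∑[ i < k ] collisions (cs i)

  totalCollisions-pairs : totalCollisions ≡ ∑[ x < v ] ∑[ y < v ] agreements x y
  totalCollisions-pairs = trans (∑-comm (λ i x → ∑[ y < v ] δ (cs i x) (cs i y)))
                                (sum-cong-≗ (λ x → ∑-comm (λ i y → δ (cs i x) (cs i y))))

  upperCount : totalCollisions + degSum G ≤ v * (w + k)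
  upperCount = begin
    totalCollisions + degSum G
      ≡⟨ cong₂ _+_ totalCollisions-pairs degSum-adj ⟩
    ∑[ x < v ] ∑[ y < v ] agreements x y + ∑[ x < v ] ∑[ y < v ] adj x y
      ≡⟨ sym (∑-distrib-+ (λ x → ∑[ y < v ] agreements x y) (λ x → ∑[ y < v ] adj x y)) ⟩
    ∑[ x < v ] (∑[ y < v ] agreements x y + ∑[ y < v ] adj x y)
      ≡⟨ sum-cong-≗ (λ x → sym (∑-distrib-+ (agreements x) (adj x))) ⟩
    ∑[ x < v ] ∑[ y < v ] (agreements x y + adj x y)
      ≤⟨ pairBound ⟩
    v * (k + w)
      ≡⟨ cong (v *_) (+-comm k w) ⟩
    v * (w + k) ∎
    where open ≤-Reasoning

  lowerCount : k * (v * v) ≤ n * totalCollisions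
  lowerCount = begin
    k * (v * v)                      ≡⟨ sym (∑-const k (v * v)) ⟩
    ∑[ i < k ] (v * v)               ≤⟨ ∑-mono-≤ (λ i → collision-bound (cs i)) ⟩
    ∑[ i < k ] (n * collisions (cs i)) ≡⟨ sym (*-distribˡ-sum n (λ i → collisions (cs i))) ⟩
    n * totalCollisions              ∎
    where open ≤-Reasoning

ceilDiv-≤ : ∀ a b {n} → a ≤ n * b → ceilDiv a b ≤ n
ceilDiv-≤ a zero    _    = z≤n
ceilDiv-≤ a (suc b) {n} a≤nb = s≤s⁻¹ (m<n*o⇒m/o<n (s≤s a+b≤b+nb))
  where
  a+b≤b+nb : a + b ≤ b + n * suc b
  a+b≤b+nb = ≤-trans (≤-reflexive (+-comm a b)) (+-monoʳ-≤ b a≤nb)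

-- Every n admitting k pairwise orthogonal n-colourings is at least the bound: compare
-- the lower and upper counts and clear the denominator.  For v = 0 the bound is 0.
orthColorings-bound : ∀ {v k n} (G : Graph v) → HasOrthColorings k G n → bound k G ≤ n
orthColorings-bound {zero}          G _ = ceilDiv-≤ 0 (0 ∸ degSum G) z≤n
orthColorings-bound {suc w} {k} {n} G (cs , proper , orth) =
  ceilDiv-≤ (v * v * k) (v * (w + k) ∸ degSum G) (begin
  v * v * k                               ≡⟨ *-comm (v * v) k ⟩
  k * (v * v)                             ≤⟨ lowerCount ⟩
  n * totalCollisions                     ≤⟨ *-monoʳ-≤ n (m+n≤o⇒m≤o∸n totalCollisions upperCount) ⟩
  n * (v * (w + k) ∸ degSum G)            ∎)
  where
  open ≤-Reasoning
  open OrthogonalFamily G cs proper orth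

-- Oχ_k(G) itself admits k pairwise orthogonal colourings, so it satisfies the bound.
corollary2p7 : (v : ℕ) → .{{_ : NonZero v}} → (G : Graph v) → (k : ℕ) → .{{_ : NonZero k}} →
    (n : ℕ) → IsOrthChromaticNumber k G n → bound k G ≤ n
corollary2p7 v G k n (orthColorings , _) = orthColorings-bound G orthColorings
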